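{- Let $p$ be a prime, let $n,k>0$ be integers and let $a\in\mathbb{F}_p^*$. If the polynomial $x^n(x^k+a)$ permutes $\mathbb{F}_p$, then $\gcd(k,p-1)\ge \sqrt{p-(3/4)}-(1/2) > \sqrt{p}-1$.
   Context: A polynomial $f\in\mathbb{F}_q[x]$ is said to permute $\mathbb{F}_q$ if the map $\alpha\mapsto f(\alpha)$ is a bijection $\mathbb{F}_q\to\mathbb{F}_q$. -}

module Defs where

open import Data.Nat using (ℕ; _+_; _*_; _^_; NonZero)
open import Data.Nat.DivMod using (_mod_)
open import Data.Nat.Primality using (Prime; prime⇒nonZero)
open import Data.Fin using (Fin; toℕ)
open import Function.Definitions using (Bijective)
open import Relation.Binary.PropositionalEquality using (_≡_)

-- Elements of F_p are represented by Fin p (residues 0..p-1), with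
-- arithmetic done in ℕ and reduced mod p.
-- The polynomial map  α ↦ α^n (α^k + a)  on F_p.
polyMap : (p : ℕ) → Prime p → (n k : ℕ) → Fin p → Fin p → Fin p
polyMap p pp n k a α =
  ((toℕ α ^ n) * (toℕ α ^ k + toℕ a)) mod p
  where instance _ = prime⇒nonZero pp

Permutes : (p : ℕ) → Prime p → (n k : ℕ) → Fin p → Set
Permutes p pp n k a = Bijective _≡_ _≡_ (polyMap p pp n k a)

{-# OPTIONS --safe #-}
module Submission where

-- Write g = gcd(k, p − 1), p − 1 = m g and k = k′ g with m and k′ coprime, and
-- f(x) = x^n (x^k + a).  If f permutes F_p then Σ_x f(x)^t = Σ_y y^t ≡ 0 for
-- t < p − 1.  Expanding binomially, Σ_x f(x)^t ≡ −Σ C(t,i) a^(t−i) over those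
-- i ≤ t with p − 1 ∣ n t + k i, because Σ_x x^e ≡ −1 or 0 (e > 0) according as
-- p − 1 divides e or not; this in turn comes from Pascal's identity for power
-- sums and Fermat's little theorem.  For t = g u the condition on i reads
-- i ≡ u s (mod m), where n + k′ s ≡ 0 (mod m).  If m > g there is a 0 < u < m
-- for which the least residue of u s is the only such i in [0, g u], so the sum
-- is a single term that p does not divide: a contradiction.  Hence m ≤ g, that
-- is p − 1 ≤ g², and both bounds follow.

open import Defs
open import Data.Nat using (ℕ; _+_; _*_; _∸_; _≤_; _<_)
open import Data.Nat.GCD using (gcd)
open import Data.Nat.Primality using (Prime)
open import Data.Fin using (Fin; toℕ)
open import Data.Product using (_×_)
open import Relation.Binary.PropositionalEquality using (_≢_)

open import Level using (0ℓ)
open import Algebra.Bundles using (CommutativeSemiring)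
open import Algebra.Structures using (IsCommutativeMonoid)
open import Algebra.Structures.Biased using (isCommutativeSemiringˡ)
open import Data.Fin.Properties using (toℕ<n; toℕ-fromℕ<)
open import Data.Nat
open import Data.Nat.Combinatorics using (_C_; nCn≡1; nC1≡n; nCk≡nC[n∸k]; nCk≡n!/k![n-k]!; k![n∸k]!∣n!)
open import Data.Nat.Coprimality using (Coprime; coprime-divisor; coprime-Bézout; coprime-/gcd; prime⇒coprime)
import Data.Nat.Coprimality as Coprime
open import Data.Nat.Divisibility
open import Data.Nat.DivMod
open import Data.Nat.GCD using (module Bézout; gcd[m,n]∣m; gcd[m,n]∣n; gcd[m,n]≢0; n/gcd[m,n]≢0)
open import Data.Nat.Induction using (<-rec)
open import Data.Nat.Primality using (euclidsLemma; prime⇒nonZero; prime⇒nonTrivial)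
open import Data.Nat.Properties
open import Data.Nat.Tactic.RingSolver using (solve-∀)
open import Data.Product using (_,_; ∃-syntax)
open import Data.Sum using (inj₁; inj₂)
open import Function using (_on_; _∘_)
open import Function.Bundles using (mk⤖)
open import Function.Definitions using (Bijective)
open import Function.Properties.Bijection using (⤖⇒↔)
open import Relation.Binary.PropositionalEquality
open import Relation.Nullary.Decidable using (yes; no)
open import Relation.Nullary.Negation using (¬_; contradiction)
import Relation.Binary.Construct.On as On
import Relation.Binary.Reasoning.Setoid

open import Algebra.Properties.Semiring.Sum +-*-semiring
  using (sum-syntax; sum⁺-syntax; sum-cong-≗; sum-replicate-zero; ∑-distrib-+; ∑-comm; *-distribˡ-sum; sum-permute)
import Algebra.Properties.CommutativeSemiring.Binomial +-*-commutativeSemiring as Binomial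
import Algebra.Definitions.RawSemiring +-*-rawSemiring as Raw

∑-last : ∀ n (f : ℕ → ℕ) → ∑[ i < suc n ] f (toℕ i) ≡ ∑[ i < n ] f (toℕ i) + f n
∑-last zero    f = +-comm (f 0) 0
∑-last (suc n) f = begin
  f 0 + ∑[ i < suc n ] f (suc (toℕ i))            ≡⟨ cong (f 0 +_) (∑-last n (f ∘ suc)) ⟩
  f 0 + (∑[ i < n ] f (suc (toℕ i)) + f (suc n))  ≡⟨ +-assoc (f 0) _ _ ⟨
  f 0 + ∑[ i < n ] f (suc (toℕ i)) + f (suc n)    ∎
  where open ≡-Reasoning

binomial-theorem : ∀ t x y → (x + y) ^ t ≡ ∑[ i ≤ t ] ((t C toℕ i) * x ^ toℕ i * y ^ (t ∸ toℕ i))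
binomial-theorem t x y = begin
  (x + y) ^ t                       ≡⟨ ^≡^ (x + y) t ⟨
  (x + y) Raw.^ t                   ≡⟨ Binomial.theorem t x y ⟩
  Binomial.binomialExpansion x y t  ≡⟨ sum-cong-≗ term ⟩
  ∑[ i ≤ t ] ((t C toℕ i) * x ^ toℕ i * y ^ (t ∸ toℕ i)) ∎
  where
  open ≡-Reasoning
  ^≡^ : ∀ x n → x Raw.^ n ≡ x ^ n
  ^≡^ x zero    = refl
  ^≡^ x (suc n) = cong (x *_) (^≡^ x n)
  ×≡* : ∀ n x → n Raw.× x ≡ n * x
  ×≡* zero    x = refl
  ×≡* (suc n) x = cong (x +_) (×≡* n x)
  term : ∀ i → Binomial.binomialTerm x y t i ≡ (t C toℕ i) * x ^ toℕ i * y ^ (t ∸ toℕ i)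
  term i = trans (×≡* (t C toℕ i) _)
                 (trans (cong₂ (λ u v → (t C toℕ i) * (u * v)) (^≡^ x (toℕ i)) (^≡^ y (t ∸ toℕ i)))
                        (sym (*-assoc (t C toℕ i) _ _)))

binomial-suc : ∀ t x → suc x ^ t ≡ ∑[ i ≤ t ] ((t C toℕ i) * x ^ toℕ i)
binomial-suc t x = begin
  suc x ^ t                                          ≡⟨ cong (_^ t) (+-comm 1 x) ⟩
  (x + 1) ^ t                                        ≡⟨ binomial-theorem t x 1 ⟩
  ∑[ i ≤ t ] ((t C toℕ i) * x ^ toℕ i * 1 ^ (t ∸ toℕ i)) ≡⟨ sum-cong-≗ drop-1^ ⟩
  ∑[ i ≤ t ] ((t C toℕ i) * x ^ toℕ i)               ∎
  where
  open ≡-Reasoning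
  drop-1^ : ∀ (i : Fin (suc t)) → (t C toℕ i) * x ^ toℕ i * 1 ^ (t ∸ toℕ i) ≡ (t C toℕ i) * x ^ toℕ i
  drop-1^ i = trans (cong ((t C toℕ i) * x ^ toℕ i *_) (^-zeroˡ (t ∸ toℕ i))) (*-identityʳ _)

^-distribʳ-* : ∀ m n t → (m * n) ^ t ≡ m ^ t * n ^ t
^-distribʳ-* m n zero    = refl
^-distribʳ-* m n (suc t) = begin
  m * n * (m * n) ^ t      ≡⟨ cong (m * n *_) (^-distribʳ-* m n t) ⟩
  m * n * (m ^ t * n ^ t)  ≡⟨ [m*n]*[o*p]≡[m*o]*[n*p] m n (m ^ t) (n ^ t) ⟩
  m * m ^ t * (n * n ^ t)  ∎
  where open ≡-Reasoning

nCk*k!*[n∸k]!≡n! : ∀ {n k} → k ≤ n → (n C k) * (k ! * (n ∸ k) !) ≡ n !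
nCk*k!*[n∸k]!≡n! {n} {k} k≤n =
  trans (cong (_* (k ! * (n ∸ k) !)) (nCk≡n!/k![n-k]! k≤n))
        (m/n*n≡m {{k !* (n ∸ k) !≢0}} (k![n∸k]!∣n! k≤n))

[1+n]Cn≡1+n : ∀ n → suc n C n ≡ suc n
[1+n]Cn≡1+n n = trans (nCk≡nC[n∸k] (n≤1+n n)) (trans (cong (suc n C_) (m+n∸n≡m 1 n)) (nC1≡n (suc n)))

powerSum : ℕ → ℕ → ℕ
powerSum N e = ∑[ x < N ] (toℕ x ^ e)

powerSum-pascal : ∀ N e → ∑[ j ≤ e ] ((suc e C toℕ j) * powerSum N (toℕ j)) ≡ N ^ suc e
powerSum-pascal zero    e = trans (sum-cong-≗ vanish) (sum-replicate-zero (suc e))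
  where
  vanish : ∀ (j : Fin (suc e)) → (suc e C toℕ j) * powerSum 0 (toℕ j) ≡ 0
  vanish j = *-zeroʳ (suc e C toℕ j)
powerSum-pascal (suc N) e = begin
  ∑[ j ≤ e ] (c j * powerSum (suc N) (toℕ j))
    ≡⟨ sum-cong-≗ {suc e} add-last ⟩
  ∑[ j ≤ e ] (c j * powerSum N (toℕ j) + c j * N ^ toℕ j)
    ≡⟨ ∑-distrib-+ {suc e} (λ j → c j * powerSum N (toℕ j)) (λ j → c j * N ^ toℕ j) ⟩
  ∑[ j ≤ e ] (c j * powerSum N (toℕ j)) + ∑[ j ≤ e ] (c j * N ^ toℕ j)
    ≡⟨ cong (_+ ∑[ j ≤ e ] (c j * N ^ toℕ j)) (powerSum-pascal N e) ⟩
  N ^ suc e + ∑[ j ≤ e ] (c j * N ^ toℕ j)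
    ≡⟨ +-comm (N ^ suc e) _ ⟩
  ∑[ j ≤ e ] (c j * N ^ toℕ j) + N ^ suc e
    ≡⟨ cong (∑[ j ≤ e ] (c j * N ^ toℕ j) +_) top-term ⟨
  ∑[ j ≤ e ] (c j * N ^ toℕ j) + (suc e C suc e) * N ^ suc e
    ≡⟨ ∑-last (suc e) (λ j → (suc e C j) * N ^ j) ⟨
  ∑[ j ≤ suc e ] (c j * N ^ toℕ j)
    ≡⟨ binomial-suc (suc e) N ⟨
  suc N ^ suc e
    ∎
  where
  open ≡-Reasoning
  c : ∀ {n} → Fin n → ℕ
  c j = suc e C toℕ j
  add-last : ∀ (j : Fin (suc e)) → c j * powerSum (suc N) (toℕ j) ≡ c j * powerSum N (toℕ j) + c j * N ^ toℕ j
  add-last j = trans (cong (c j *_) (∑-last N (_^ toℕ j))) (*-distribˡ-+ (c j) _ _)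
  top-term : (suc e C suc e) * N ^ suc e ≡ N ^ suc e
  top-term = trans (cong (_* N ^ suc e) (nCn≡1 (suc e))) (*-identityˡ (N ^ suc e))

power-expansion : ∀ z n k A t →
  (z ^ n * (z ^ k + A)) ^ t ≡ ∑[ i ≤ t ] ((t C toℕ i) * A ^ (t ∸ toℕ i) * z ^ (n * t + k * toℕ i))
power-expansion z n k A t = begin
  (z ^ n * (z ^ k + A)) ^ t
    ≡⟨ ^-distribʳ-* (z ^ n) (z ^ k + A) t ⟩
  (z ^ n) ^ t * (z ^ k + A) ^ t
    ≡⟨ cong₂ _*_ (^-*-assoc z n t) (binomial-theorem t (z ^ k) A) ⟩
  z ^ (n * t) * ∑[ i ≤ t ] (c i * (z ^ k) ^ toℕ i * a i)
    ≡⟨ *-distribˡ-sum {suc t} (z ^ (n * t)) (λ i → c i * (z ^ k) ^ toℕ i * a i) ⟩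
  ∑[ i ≤ t ] (z ^ (n * t) * (c i * (z ^ k) ^ toℕ i * a i))
    ≡⟨ sum-cong-≗ {suc t} collect ⟩
  ∑[ i ≤ t ] (c i * a i * z ^ (n * t + k * toℕ i))
    ∎
  where
  open ≡-Reasoning
  c a : Fin (suc t) → ℕ
  c i = t C toℕ i
  a i = A ^ (t ∸ toℕ i)
  regroup : ∀ w c y a → w * (c * y * a) ≡ c * a * (w * y)
  regroup = solve-∀
  collect : ∀ i → z ^ (n * t) * (c i * (z ^ k) ^ toℕ i * a i) ≡ c i * a i * z ^ (n * t + k * toℕ i)
  collect i = begin
    z ^ (n * t) * (c i * (z ^ k) ^ toℕ i * a i)  ≡⟨ cong (λ y → z ^ (n * t) * (c i * y * a i))
                                                          (^-*-assoc z k (toℕ i)) ⟩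
    z ^ (n * t) * (c i * z ^ (k * toℕ i) * a i)  ≡⟨ regroup (z ^ (n * t)) (c i) (z ^ (k * toℕ i)) (a i) ⟩
    c i * a i * (z ^ (n * t) * z ^ (k * toℕ i))  ≡⟨ cong (c i * a i *_) (^-distribˡ-+-* z (n * t) (k * toℕ i)) ⟨
    c i * a i * z ^ (n * t + k * toℕ i)          ∎

∑-power-expansion : ∀ N n k A t → ∑[ x < N ] ((toℕ x ^ n * (toℕ x ^ k + A)) ^ t)
                                  ≡ ∑[ i ≤ t ] ((t C toℕ i) * A ^ (t ∸ toℕ i) * powerSum N (n * t + k * toℕ i))
∑-power-expansion N n k A t = begin
  ∑[ x < N ] ((toℕ x ^ n * (toℕ x ^ k + A)) ^ t)
    ≡⟨ sum-cong-≗ {N} (λ x → power-expansion (toℕ x) n k A t) ⟩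
  ∑[ x < N ] ∑[ i ≤ t ] (c i * toℕ x ^ e i)
    ≡⟨ ∑-comm {N} {suc t} (λ x i → c i * toℕ x ^ e i) ⟩
  ∑[ i ≤ t ] ∑[ x < N ] (c i * toℕ x ^ e i)
    ≡⟨ sum-cong-≗ {suc t} (λ i → *-distribˡ-sum {N} (c i) (λ x → toℕ x ^ e i)) ⟨
  ∑[ i ≤ t ] (c i * powerSum N (e i))
    ∎
  where
  open ≡-Reasoning
  c e : Fin (suc t) → ℕ
  c i = (t C toℕ i) * A ^ (t ∸ toℕ i)
  e i = n * t + k * toℕ i

module ModularArithmetic (d : ℕ) .{{_ : NonZero d}} where

  infix 4 _≈_
  _≈_ : ℕ → ℕ → Set
  _≈_ = _≡_ on (_% d)

  m%d≈m : ∀ m → m % d ≈ m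
  m%d≈m m = m%n%n≡m%n m d

  +-cong : ∀ {a b x y} → a ≈ b → x ≈ y → a + x ≈ b + y
  +-cong {a} {b} {x} {y} a≈b x≈y = begin
    (a + x) % d            ≡⟨ %-distribˡ-+ a x d ⟩
    (a % d + x % d) % d    ≡⟨ cong₂ (λ u v → (u + v) % d) a≈b x≈y ⟩
    (b % d + y % d) % d    ≡⟨ %-distribˡ-+ b y d ⟨
    (b + y) % d            ∎
    where open ≡-Reasoning

  *-cong : ∀ {a b x y} → a ≈ b → x ≈ y → a * x ≈ b * y
  *-cong {a} {b} {x} {y} a≈b x≈y = begin
    (a * x) % d            ≡⟨ %-distribˡ-* a x d ⟩
    (a % d * (x % d)) % d  ≡⟨ cong₂ (λ u v → (u * v) % d) a≈b x≈y ⟩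
    (b % d * (y % d)) % d  ≡⟨ %-distribˡ-* b y d ⟨
    (b * y) % d            ∎
    where open ≡-Reasoning

  ^-cong : ∀ {a b} e → a ≈ b → a ^ e ≈ b ^ e
  ^-cong zero    a≈b = refl
  ^-cong (suc e) a≈b = *-cong a≈b (^-cong e a≈b)

  ℕ/d : CommutativeSemiring 0ℓ 0ℓ
  ℕ/d = record
    { Carrier = ℕ ; _≈_ = _≈_ ; _+_ = _+_ ; _*_ = _*_ ; 0# = 0 ; 1# = 1
    ; isCommutativeSemiring = isCommutativeSemiringˡ record
      { +-isCommutativeMonoid = lift +-cong +-0-isCommutativeMonoid
      ; *-isCommutativeMonoid = lift *-cong *-1-isCommutativeMonoid
      ; distribʳ              = λ x y z → cong (_% d) (*-distribʳ-+ x y z)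
      ; zeroˡ                 = λ x → cong (_% d) (*-zeroˡ x)
      }
    }
    where
    lift : ∀ {_∙_ ε} → (∀ {a b x y} → a ≈ b → x ≈ y → a ∙ x ≈ b ∙ y) →
           IsCommutativeMonoid _≡_ _∙_ ε → IsCommutativeMonoid _≈_ _∙_ ε
    lift ∙-cong M = record
      { isMonoid = record
        { isSemigroup = record
          { isMagma = record { isEquivalence = On.isEquivalence (_% d) isEquivalence ; ∙-cong = ∙-cong }
          ; assoc   = λ x y z → cong (_% d) (assoc x y z) }
        ; identity = (λ x → cong (_% d) (identityˡ x)) , (λ x → cong (_% d) (identityʳ x)) }
      ; comm = λ x y → cong (_% d) (comm x y) }
      where open IsCommutativeMonoid M using (assoc; identityˡ; identityʳ; comm)

  module ≈-Reasoning = Relation.Binary.Reasoning.Setoid (CommutativeSemiring.setoid ℕ/d)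

  ≈⇒∣∸ : ∀ {a b} → a ≈ b → d ∣ b ∸ a
  ≈⇒∣∸ {a} {b} a≈b = divides (b / d ∸ a / d) (begin
    b ∸ a                                      ≡⟨ cong₂ _∸_ (m≡m%n+[m/n]*n b d) (m≡m%n+[m/n]*n a d) ⟩
    (b % d + b / d * d) ∸ (a % d + a / d * d)  ≡⟨ cong (λ r → (b % d + b / d * d) ∸ (r + a / d * d)) a≈b ⟩
    (b % d + b / d * d) ∸ (b % d + a / d * d)  ≡⟨ [m+n]∸[m+o]≡n∸o (b % d) _ _ ⟩
    b / d * d ∸ a / d * d                      ≡⟨ *-distribʳ-∸ d (b / d) (a / d) ⟨
    (b / d ∸ a / d) * d                        ∎)
    where open ≡-Reasoning

  private
    %-remove-∸ : ∀ {a b} → a ≤ b → d ∣ b ∸ a → b % d ≡ a % d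
    %-remove-∸ {a} a≤b d∣b∸a = trans (cong (_% d) (sym (m+[n∸m]≡n a≤b))) (%-remove-+ʳ a d∣b∸a)

  ∣∸⇒≈ : ∀ {a b} → d ∣ b ∸ a → d ∣ a ∸ b → a ≈ b
  ∣∸⇒≈ {a} {b} d∣b∸a d∣a∸b with ≤-total a b
  ... | inj₁ a≤b = sym (%-remove-∸ a≤b d∣b∸a)
  ... | inj₂ b≤a = %-remove-∸ b≤a d∣a∸b

  ∣⇒≈0 : ∀ {a} → d ∣ a → a ≈ 0
  ∣⇒≈0 {a} d∣a = ∣∸⇒≈ (subst (d ∣_) (sym (0∸n≡0 a)) (d ∣0)) d∣a

  ≈0⇒∣ : ∀ {a} → a ≈ 0 → d ∣ a
  ≈0⇒∣ a≈0 = ≈⇒∣∸ (sym a≈0)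

  +-cancelˡ-≈ : ∀ x {a b} → x + a ≈ x + b → a ≈ b
  +-cancelˡ-≈ x x+a≈x+b = ∣∸⇒≈ (cancel x+a≈x+b) (cancel (sym x+a≈x+b))
    where
    cancel : ∀ {a b} → x + a ≈ x + b → d ∣ b ∸ a
    cancel {a} {b} e = subst (d ∣_) ([m+n]∸[m+o]≡n∸o x b a) (≈⇒∣∸ e)

  *-cancelˡ-≈ : ∀ {x a b} → Coprime d x → x * a ≈ x * b → a ≈ b
  *-cancelˡ-≈ {x} d⊥x x*a≈x*b = ∣∸⇒≈ (cancel x*a≈x*b) (cancel (sym x*a≈x*b))
    where
    cancel : ∀ {a b} → x * a ≈ x * b → d ∣ b ∸ a
    cancel {a} {b} e = coprime-divisor d⊥x (subst (d ∣_) (sym (*-distribˡ-∸ x b a)) (≈⇒∣∸ e))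

  ≈∧close⇒≡ : ∀ {a b} → a ≈ b → b < a + d → a < b + d → a ≡ b
  ≈∧close⇒≡ a≈b b<a+d a<b+d =
    ≤-antisym (close⇒≤ (≈⇒∣∸ (sym a≈b)) a<b+d) (close⇒≤ (≈⇒∣∸ a≈b) b<a+d)
    where
    close⇒≤ : ∀ {a b} → d ∣ b ∸ a → b < a + d → b ≤ a
    close⇒≤ {a} {b} d∣b∸a b<a+d with b ∸ a in eq
    ... | zero  = m∸n≡0⇒m≤n eq
    ... | suc _ = contradiction d∣b∸a (>⇒∤ (subst (_< d) eq (m<n+o⇒m∸n<o b a b<a+d)))

  ∑-cong-≈ : ∀ n {f g : ℕ → ℕ} → (∀ j → j < n → f j ≈ g j) →
             ∑[ j < n ] f (toℕ j) ≈ ∑[ j < n ] g (toℕ j)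
  ∑-cong-≈ n f≈g = sum-cong-≋ (λ j → f≈g (toℕ j) (toℕ<n j))
    where open import Algebra.Properties.Semiring.Sum (CommutativeSemiring.semiring ℕ/d) using (sum-cong-≋)

  ∑-vanishing : ∀ n (f : ℕ → ℕ) → (∀ j → j < n → f j ≈ 0) → ∑[ j < n ] f (toℕ j) ≈ 0
  ∑-vanishing n f vanish = begin
    ∑[ j < n ] f (toℕ j)  ≈⟨ ∑-cong-≈ n vanish ⟩
    ∑[ j < n ] 0          ≡⟨ sum-replicate-zero n ⟩
    0                     ∎
    where open ≈-Reasoning

  ∑-single : ∀ n (f : ℕ → ℕ) {i} → i < n → (∀ j → j < n → j ≢ i → f j ≈ 0) →
             ∑[ j < n ] f (toℕ j) ≈ f i
  ∑-single (suc n) f {i} i<1+n others with m<1+n⇒m<n∨m≡n i<1+n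
  ... | inj₁ i<n = begin
    ∑[ j < suc n ] f (toℕ j)    ≡⟨ ∑-last n f ⟩
    ∑[ j < n ] f (toℕ j) + f n  ≈⟨ +-cong (∑-single n f i<n (λ j → others j ∘ m<n⇒m<1+n))
                                          (others n ≤-refl (>⇒≢ i<n)) ⟩
    f i + 0                     ≡⟨ +-identityʳ (f i) ⟩
    f i                         ∎
    where open ≈-Reasoning
  ... | inj₂ refl = begin
    ∑[ j < suc n ] f (toℕ j)    ≡⟨ ∑-last n f ⟩
    ∑[ j < n ] f (toℕ j) + f n  ≈⟨ +-cong (∑-vanishing n f (λ j j<n → others j (m<n⇒m<1+n j<n) (<⇒≢ j<n)))
                                          refl ⟩
    0 + f n                     ∎
    where open ≈-Reasoning

  -- u is such that u s % d is the only number in [0, g u] congruent to u s.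
  ResidueWindow : ℕ → ℕ → Set
  ResidueWindow g s = ∃[ u ] 0 < u × u < d × u * s % d ≤ g * u × g * u < u * s % d + d

  window-unique : ∀ {g s u i} → g * u < u * s % d + d → i ≤ g * u → i ≈ u * s → i ≡ u * s % d
  window-unique {s = s} {u = u} {i = i} gu<r+d i≤gu i≈us =
    ≈∧close⇒≡ (trans i≈us (sym (m%d≈m (u * s))))
              (<-≤-trans (m%n<n (u * s) d) (m≤n+m d i))
              (≤-<-trans i≤gu gu<r+d)

  residue-step : ∀ {g s u} → g < s → s < d → suc u * s % d + d ≤ g * suc u → u * s % d < g * u
  residue-step {g} {s} {u} g<s s<d r+d≤g[1+u] =
    ≤-<-trans (≤-trans (≤-reflexive u*s≈r+[d∸s]) (m%n≤m _ d)) r+[d∸s]<g*u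
    where
    r = suc u * s % d
    s+[r+[d∸s]]≡r+d : s + (r + (d ∸ s)) ≡ r + d
    s+[r+[d∸s]]≡r+d = trans (+-comm s _) (trans (+-assoc r (d ∸ s) s) (cong (r +_) (m∸n+n≡m (<⇒≤ s<d))))
    u*s≈r+[d∸s] : u * s ≈ r + (d ∸ s)
    u*s≈r+[d∸s] = +-cancelˡ-≈ s (begin
      s + u * s          ≈⟨ m%d≈m (suc u * s) ⟨
      r                  ≈⟨ [m+n]%n≡m%n r d ⟨
      r + d              ≡⟨ s+[r+[d∸s]]≡r+d ⟨
      s + (r + (d ∸ s))  ∎)
      where open ≈-Reasoning
    r+[d∸s]<g*u : r + (d ∸ s) < g * u
    r+[d∸s]<g*u = +-cancelʳ-< s _ _ (begin-strict
      r + (d ∸ s) + s  ≡⟨ trans (+-comm _ s) s+[r+[d∸s]]≡r+d ⟩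
      r + d            ≤⟨ r+d≤g[1+u] ⟩
      g * suc u        ≡⟨ *-suc g u ⟩
      g + g * u        <⟨ +-monoˡ-< (g * u) g<s ⟩
      s + g * u        ≡⟨ +-comm s (g * u) ⟩
      g * u + s        ∎)
      where open ≤-Reasoning

  -- Starting from u = d − 1, where the lower bound is automatic, a failing
  -- upper bound at u + 1 yields the lower bound at u.
  residue-descent : ∀ {g s} → g < d → g < s → s < d →
                    ∀ u → 0 < u → u < d → u * s % d ≤ g * u → ResidueWindow g s
  residue-descent {g} {s} g<d g<s s<d u 0<u u<d r≤gu with g * u <? u * s % d + d
  ... | yes gu<r+d = u , 0<u , u<d , r≤gu , gu<r+d
  residue-descent g<d g<s s<d 1 _ _ _ | no g≮r+d =
    contradiction (<-≤-trans (subst (_< d) (sym (*-identityʳ _)) g<d) (m≤n+m d _)) g≮r+d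
  residue-descent g<d g<s s<d (suc (suc u)) _ u<d _ | no gu≮r+d =
    residue-descent g<d g<s s<d (suc u) z<s (<-trans (n<1+n (suc u)) u<d)
                    (<⇒≤ (residue-step g<s s<d (≮⇒≥ gu≮r+d)))

  residue-window : ∀ {g s} → 0 < g → g < d → s < d → ResidueWindow g s
  residue-window {g} {s} 0<g g<d s<d with s ≤? g
  ... | yes s≤g = 1 , z<s , <-≤-trans (s≤s 0<g) g<d , s%d≤g*1 , g*1<s%d+d
    where
    s%d≤g*1 : 1 * s % d ≤ g * 1
    s%d≤g*1 = ≤-trans (m%n≤m (1 * s) d) (subst₂ _≤_ (sym (*-identityˡ s)) (sym (*-identityʳ g)) s≤g)
    g*1<s%d+d : g * 1 < 1 * s % d + d
    g*1<s%d+d = <-≤-trans (subst (_< d) (sym (*-identityʳ g)) g<d) (m≤n+m d _)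
  ... | no s≰g = residue-descent g<d (≰⇒> s≰g) s<d (pred d) (pred-mono-< (<-≤-trans (s≤s 0<g) g<d))
                   (subst (pred d <_) (suc-pred d) (n<1+n (pred d)))
                   (≤-trans (<⇒≤pred (m%n<n (pred d * s) d)) (m≤n*m (pred d) g {{>-nonZero 0<g}}))

  reduce-solution : ∀ {a b} s → d ∣ b + a * s → ∃[ s ] s < d × d ∣ b + a * s
  reduce-solution {a} {b} s d∣b+as =
    s % d , m%n<n s d , ≈0⇒∣ (trans (+-cong {b} refl (*-cong {a} refl (m%d≈m s))) (∣⇒≈0 d∣b+as))

  coprime⇒solvable : ∀ {a} → Coprime d a → ∀ b → ∃[ s ] s < d × d ∣ b + a * s
  coprime⇒solvable {a} d⊥a b with coprime-Bézout d⊥a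
  ... | Bézout.+- x y 1+ya≡xd = reduce-solution {a} {b} (b * y) (divides (b * x) (begin
    b + a * (b * y)  ≡⟨ expand a b y ⟩
    b * (1 + y * a)  ≡⟨ cong (b *_) 1+ya≡xd ⟩
    b * (x * d)      ≡⟨ *-assoc b x d ⟨
    b * x * d        ∎))
    where
    open ≡-Reasoning
    expand : ∀ a b y → b + a * (b * y) ≡ b * (1 + y * a)
    expand = solve-∀
  ... | Bézout.-+ x y 1+xd≡ya = reduce-solution {a} {b} (y * (pred d * b)) (divides (b + x * pred d * b) (begin
    b + a * (y * (pred d * b))               ≡⟨ regroup a b y (pred d) ⟩
    b + y * a * pred d * b                   ≡⟨ cong (λ c → b + c * pred d * b) 1+xd≡ya ⟨
    b + (1 + x * d) * pred d * b             ≡⟨ cong (λ c → b + (1 + x * c) * pred d * b) (suc-pred d) ⟨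
    b + (1 + x * suc (pred d)) * pred d * b  ≡⟨ factor b x (pred d) ⟩
    (b + x * pred d * b) * suc (pred d)      ≡⟨ cong ((b + x * pred d * b) *_) (suc-pred d) ⟩
    (b + x * pred d * b) * d                 ∎))
    where
    open ≡-Reasoning
    regroup : ∀ a b y e → b + a * (y * (e * b)) ≡ b + y * a * e * b
    regroup = solve-∀
    factor : ∀ b x e → b + (1 + x * suc e) * e * b ≡ (b + x * e * b) * suc e
    factor = solve-∀

  solution-≈0 : ∀ {a b s} u → d ∣ b + a * s → b * u + a * (u * s) ≈ 0
  solution-≈0 {a} {b} {s} u d∣b+as = ∣⇒≈0 (subst (d ∣_) (scale a b s u) (∣n⇒∣m*n u d∣b+as))
    where
    scale : ∀ a b s u → u * (b + a * s) ≡ b * u + a * (u * s)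
    scale = solve-∀

  ∣-linear⇒≈ : ∀ {a b s u i} → Coprime d a → d ∣ b + a * s → d ∣ b * u + a * i → i ≈ u * s
  ∣-linear⇒≈ {a} {b} {s} {u} d⊥a d∣b+as d∣bu+ai =
    *-cancelˡ-≈ d⊥a (+-cancelˡ-≈ (b * u) (trans (∣⇒≈0 d∣bu+ai) (sym (solution-≈0 {a} {b} {s} u d∣b+as))))

  ≈⇒∣-linear : ∀ {a b s u i} → d ∣ b + a * s → i ≈ u * s → d ∣ b * u + a * i
  ≈⇒∣-linear {a} {b} {s} {u} d∣b+as i≈us =
    ≈0⇒∣ (trans (+-cong {b * u} refl (*-cong {a} refl i≈us)) (solution-≈0 {a} {b} {s} u d∣b+as))

module PrimeModulus (p : ℕ) (p-prime : Prime p) where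

  instance
    p≢0 : NonZero p
    p≢0 = prime⇒nonZero p-prime

  open ModularArithmetic p public

  1<p : 1 < p
  1<p = nonTrivial⇒n>1 p {{prime⇒nonTrivial p-prime}}

  instance
    p∸1≢0 : NonZero (p ∸ 1)
    p∸1≢0 = >-nonZero (m<n⇒0<n∸m 1<p)

  suc[p∸1]≡p : suc (p ∸ 1) ≡ p
  suc[p∸1]≡p = m+[n∸m]≡n (<⇒≤ 1<p)

  p∣m*n∧p∤n⇒p∣m : ∀ {m n} → p ∣ m * n → p ∤ n → p ∣ m
  p∣m*n∧p∤n⇒p∣m {m} {n} p∣mn p∤n with euclidsLemma m n p-prime p∣mn
  ... | inj₁ p∣m = p∣m
  ... | inj₂ p∣n = contradiction p∣n p∤n

  p∤* : ∀ {m n} → p ∤ m → p ∤ n → p ∤ m * n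
  p∤* p∤m p∤n p∣mn = p∤m (p∣m*n∧p∤n⇒p∣m p∣mn p∤n)

  p∤m^n : ∀ {m} → p ∤ m → ∀ n → p ∤ m ^ n
  p∤m^n p∤m zero    = >⇒∤ 1<p
  p∤m^n p∤m (suc n) = p∤* p∤m (p∤m^n p∤m n)

  p∤n! : ∀ {n} → n < p → p ∤ n !
  p∤n! {zero}  _   = >⇒∤ 1<p
  p∤n! {suc n} n<p = p∤* (>⇒∤ n<p) (p∤n! (<-trans (n<1+n n) n<p))

  p∤nCk : ∀ {n k} → n < p → k ≤ n → p ∤ n C k
  p∤nCk n<p k≤n p∣nCk = p∤n! n<p (subst (p ∣_) (nCk*k!*[n∸k]!≡n! k≤n) (∣m⇒∣m*n _ p∣nCk))

  p∣pCk : ∀ {k} → 0 < k → k < p → p ∣ p C k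
  p∣pCk 0<k k<p = p∣m*n∧p∤n⇒p∣m (subst (p ∣_) (sym (nCk*k!*[n∸k]!≡n! (<⇒≤ k<p))) p∣p!)
                                 (p∤* (p∤n! k<p) (p∤n! (∸-monoʳ-< 0<k (<⇒≤ k<p))))
    where
    p∣p! : p ∣ p !
    p∣p! = subst (λ n → n ∣ n !) suc[p∸1]≡p (m∣m*n ((p ∸ 1) !))

  fermat : ∀ x → x ^ p ≈ x
  fermat zero    = cong (_% p) (subst (λ n → 0 ^ n ≡ 0) suc[p∸1]≡p refl)
  fermat (suc x) = begin
    suc x ^ p                         ≡⟨ binomial-suc p x ⟩
    ∑[ i ≤ p ] term (toℕ i)           ≡⟨ ∑-last p term ⟩
    ∑[ i < p ] term (toℕ i) + term p  ≈⟨ +-cong (∑-single p term (<-trans z<s 1<p) middle) refl ⟩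
    1 + term p                        ≡⟨ cong (1 +_) (trans (cong (_* x ^ p) (nCn≡1 p)) (*-identityˡ (x ^ p))) ⟩
    1 + x ^ p                         ≈⟨ +-cong {1} refl (fermat x) ⟩
    1 + x                             ∎
    where
    open ≈-Reasoning
    term : ℕ → ℕ
    term i = (p C i) * x ^ i
    middle : ∀ i → i < p → i ≢ 0 → term i ≈ 0
    middle i i<p i≢0 = ∣⇒≈0 (∣m⇒∣m*n (x ^ i) (p∣pCk (n≢0⇒n>0 i≢0) i<p))

  fermat′ : ∀ {x} → 0 < x → x < p → x ^ (p ∸ 1) ≈ 1
  fermat′ {x} 0<x x<p = *-cancelˡ-≈ (prime⇒coprime p-prime {{>-nonZero 0<x}} x<p) (begin
    x * x ^ (p ∸ 1)  ≡⟨ cong (x ^_) suc[p∸1]≡p ⟩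
    x ^ p            ≈⟨ fermat x ⟩
    x                ≡⟨ *-identityʳ x ⟨
    x * 1            ∎)
    where open ≈-Reasoning

  ^-periodic : ∀ x q {e} → 0 < e → x ^ (e + q * (p ∸ 1)) ≈ x ^ e
  ^-periodic x zero    {e}     _   = cong (λ n → x ^ n % p) (+-identityʳ e)
  ^-periodic x (suc q) {suc e} 0<e = begin
    x ^ (suc e + suc q * (p ∸ 1))        ≡⟨ cong (x ^_) (shift e (p ∸ 1) (q * (p ∸ 1))) ⟩
    x ^ (e + q * (p ∸ 1) + suc (p ∸ 1))  ≡⟨ cong (λ n → x ^ (e + q * (p ∸ 1) + n)) suc[p∸1]≡p ⟩
    x ^ (e + q * (p ∸ 1) + p)            ≡⟨ ^-distribˡ-+-* x (e + q * (p ∸ 1)) p ⟩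
    x ^ (e + q * (p ∸ 1)) * x ^ p        ≈⟨ *-cong {x ^ (e + q * (p ∸ 1))} refl (fermat x) ⟩
    x ^ (e + q * (p ∸ 1)) * x            ≡⟨ *-comm _ x ⟩
    x ^ (suc e + q * (p ∸ 1))            ≈⟨ ^-periodic x q 0<e ⟩
    x ^ suc e                            ∎
    where
    open ≈-Reasoning
    shift : ∀ e r s → suc e + (r + s) ≡ e + s + suc r
    shift = solve-∀

  powerSum-vanishes : ∀ e → e < p ∸ 1 → powerSum p e ≈ 0
  powerSum-vanishes = <-rec (λ e → e < p ∸ 1 → powerSum p e ≈ 0) step
    where
    step : ∀ e → (∀ {j} → j < e → j < p ∸ 1 → powerSum p j ≈ 0) → e < p ∸ 1 → powerSum p e ≈ 0
    step e below e<p∸1 = *-cancelˡ-≈ (prime⇒coprime p-prime 1+e<p) (begin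
      suc e * powerSum p e     ≡⟨ cong (_* powerSum p e) ([1+n]Cn≡1+n e) ⟨
      term e                   ≈⟨ ∑-single (suc e) term ≤-refl lower ⟨
      ∑[ j ≤ e ] term (toℕ j)  ≡⟨ powerSum-pascal p e ⟩
      p ^ suc e                ≈⟨ ∣⇒≈0 (m∣m*n (p ^ e)) ⟩
      0                        ≡⟨ *-zeroʳ (suc e) ⟨
      suc e * 0                ∎)
      where
      open ≈-Reasoning
      1+e<p : suc e < p
      1+e<p = subst (suc e <_) suc[p∸1]≡p (s≤s e<p∸1)
      term : ℕ → ℕ
      term j = (suc e C j) * powerSum p j
      lower : ∀ j → j < suc e → j ≢ e → term j ≈ 0
      lower j j<1+e j≢e = trans (*-cong {suc e C j} refl (below j<e (<-trans j<e e<p∸1)))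
                                (cong (_% p) (*-zeroʳ (suc e C j)))
        where j<e = ≤∧≢⇒< (s≤s⁻¹ j<1+e) j≢e

  powerSum-periodic : ∀ q {e} → 0 < e → powerSum p (e + q * (p ∸ 1)) ≈ powerSum p e
  powerSum-periodic q 0<e = ∑-cong-≈ p (λ x _ → ^-periodic x q 0<e)

  powerSum-nondivisible : ∀ {e} → 0 < e → p ∸ 1 ∤ e → powerSum p e ≈ 0
  powerSum-nondivisible {e} 0<e p∸1∤e = begin
    powerSum p e                                      ≡⟨ cong (powerSum p) (m≡m%n+[m/n]*n e (p ∸ 1)) ⟩
    powerSum p (e % (p ∸ 1) + e / (p ∸ 1) * (p ∸ 1))  ≈⟨ powerSum-periodic (e / (p ∸ 1)) 0<e%[p∸1] ⟩
    powerSum p (e % (p ∸ 1))                          ≈⟨ powerSum-vanishes (e % (p ∸ 1)) (m%n<n e (p ∸ 1)) ⟩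
    0                                                 ∎
    where
    open ≈-Reasoning
    0<e%[p∸1] : 0 < e % (p ∸ 1)
    0<e%[p∸1] = n≢0⇒n>0 (p∸1∤e ∘ m%n≡0⇒n∣m e (p ∸ 1))

  powerSum-divisible : ∀ {e} → 0 < e → p ∸ 1 ∣ e → powerSum p e ≈ p ∸ 1
  powerSum-divisible {e} 0<e (divides (suc q) refl) = begin
    powerSum p (p ∸ 1 + q * (p ∸ 1))                      ≈⟨ powerSum-periodic q (m<n⇒0<n∸m 1<p) ⟩
    powerSum p (p ∸ 1)                                    ≡⟨ cong (λ n → powerSum n (p ∸ 1)) suc[p∸1]≡p ⟨
    0 ^ (p ∸ 1) + ∑[ x < p ∸ 1 ] (suc (toℕ x) ^ (p ∸ 1))  ≈⟨ +-cong (cong (_% p) 0^[p∸1]≡0)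
                                                                      (∑-cong-≈ (p ∸ 1) units) ⟩
    0 + ∑[ x < p ∸ 1 ] 1                                  ≡⟨ ∑1≡n (p ∸ 1) ⟩
    p ∸ 1                                                 ∎
    where
    open ≈-Reasoning
    0^[p∸1]≡0 : 0 ^ (p ∸ 1) ≡ 0
    0^[p∸1]≡0 = subst (λ n → 0 ^ n ≡ 0) (suc-pred (p ∸ 1)) refl
    units : ∀ x → x < p ∸ 1 → suc x ^ (p ∸ 1) ≈ 1
    units x x<p∸1 = fermat′ z<s (subst (suc x <_) suc[p∸1]≡p (s≤s x<p∸1))
    ∑1≡n : ∀ n → ∑[ x < n ] 1 ≡ n
    ∑1≡n zero    = refl
    ∑1≡n (suc n) = cong suc (∑1≡n n)

  bijective⇒∑^≈0 : ∀ {h : Fin p → Fin p} → Bijective _≡_ _≡_ h →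
                   ∀ {t} → t < p ∸ 1 → ∑[ x < p ] (toℕ (h x) ^ t) ≈ 0
  bijective⇒∑^≈0 h-bijective {t} t<p∸1 =
    trans (cong (_% p) (sym (sum-permute (λ y → toℕ y ^ t) (⤖⇒↔ (mk⤖ h-bijective)))))
          (powerSum-vanishes t t<p∸1)

  unique-divisible-exponent⇒∑≉0 : ∀ {n k A t i₀} → 0 < n → 0 < t → t < p → p ∤ A → i₀ ≤ t →
    p ∸ 1 ∣ n * t + k * i₀ → (∀ i → i ≤ t → p ∸ 1 ∣ n * t + k * i → i ≡ i₀) →
    ¬ (∑[ x < p ] ((toℕ x ^ n * (toℕ x ^ k + A)) ^ t) ≈ 0)
  unique-divisible-exponent⇒∑≉0 {n} {k} {A} {t} {i₀} 0<n 0<t t<p p∤A i₀≤t divisible-i₀ only-i₀ ∑≈0 =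
    p∤* (p∤* (p∤nCk t<p i₀≤t) (p∤m^n p∤A (t ∸ i₀))) (>⇒∤ p∸1<p) (≈0⇒∣ (begin
      c i₀ * (p ∸ 1)
        ≈⟨ *-cong {c i₀} refl (powerSum-divisible (0<e i₀) divisible-i₀) ⟨
      term i₀
        ≈⟨ ∑-single (suc t) term (s≤s i₀≤t) others ⟨
      ∑[ i ≤ t ] term (toℕ i)
        ≡⟨ ∑-power-expansion p n k A t ⟨
      ∑[ x < p ] ((toℕ x ^ n * (toℕ x ^ k + A)) ^ t)
        ≈⟨ ∑≈0 ⟩
      0
        ∎))
    where
    open ≈-Reasoning
    c e term : ℕ → ℕ
    c i = (t C i) * A ^ (t ∸ i)
    e i = n * t + k * i
    term i = c i * powerSum p (e i)
    p∸1<p : p ∸ 1 < p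
    p∸1<p = subst (p ∸ 1 <_) suc[p∸1]≡p (n<1+n (p ∸ 1))
    0<e : ∀ i → 0 < e i
    0<e i = ≤-trans (*-mono-≤ 0<n 0<t) (m≤m+n (n * t) (k * i))
    others : ∀ i → i < suc t → i ≢ i₀ → term i ≈ 0
    others i i<1+t i≢i₀ =
      trans (*-cong {c i} refl (powerSum-nondivisible (0<e i) (i≢i₀ ∘ only-i₀ i (s≤s⁻¹ i<1+t))))
            (cong (_% p) (*-zeroʳ (c i)))

module PermutationBound (p : ℕ) (p-prime : Prime p) (n k : ℕ) (a : Fin p) (0<n : 0 < n) (0<k : 0 < k) where

  open PrimeModulus p p-prime

  g = gcd k (p ∸ 1)

  instance
    g≢0 : NonZero g
    g≢0 = ≢-nonZero (gcd[m,n]≢0 k (p ∸ 1) (inj₁ (>⇒≢ 0<k)))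

  m k′ : ℕ
  m  = (p ∸ 1) / g
  k′ = k / g

  instance
    m≢0 : NonZero m
    m≢0 = ≢-nonZero (n/gcd[m,n]≢0 k (p ∸ 1))

  module Mod-m = ModularArithmetic m

  p∸1≡m*g : p ∸ 1 ≡ m * g
  p∸1≡m*g = sym (m/n*n≡m (gcd[m,n]∣n k (p ∸ 1)))

  m⊥k′ : Coprime m k′
  m⊥k′ = Coprime.sym (coprime-/gcd k (p ∸ 1))

  exponent≡ : ∀ u i → n * (g * u) + k * i ≡ (n * u + k′ * i) * g
  exponent≡ u i = trans (cong (λ c → n * (g * u) + c * i) (sym (m/n*n≡m (gcd[m,n]∣m k (p ∸ 1)))))
                        (factor n g u k′ i)
    where
    factor : ∀ n g u k′ i → n * (g * u) + k′ * g * i ≡ (n * u + k′ * i) * g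
    factor = solve-∀

  [p∸1]∣⇒m∣ : ∀ {u i} → p ∸ 1 ∣ n * (g * u) + k * i → m ∣ n * u + k′ * i
  [p∸1]∣⇒m∣ {u} {i} = *-cancelʳ-∣ g ∘ subst₂ _∣_ p∸1≡m*g (exponent≡ u i)

  m∣⇒[p∸1]∣ : ∀ {u i} → m ∣ n * u + k′ * i → p ∸ 1 ∣ n * (g * u) + k * i
  m∣⇒[p∸1]∣ {u} {i} = subst₂ _∣_ (sym p∸1≡m*g) (sym (exponent≡ u i)) ∘ *-monoˡ-∣ g

  g≮m : toℕ a ≢ 0 → Permutes p p-prime n k a → ¬ g < m
  g≮m a≢0 permutes g<m with Mod-m.coprime⇒solvable m⊥k′ n
  ... | s , s<m , m∣n+k′s with Mod-m.residue-window (>-nonZero⁻¹ g) g<m s<m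
  ... | u , 0<u , u<m , r≤t , t<r+m =
    unique-divisible-exponent⇒∑≉0 {n} {k} {toℕ a} {t} 0<n (*-mono-≤ (>-nonZero⁻¹ g) 0<u) t<p
      (>⇒∤ {{≢-nonZero a≢0}} (toℕ<n a)) r≤t divisible-r only-r ∑f^t≈0
    where
    t = g * u
    t<p∸1 : t < p ∸ 1
    t<p∸1 = subst (t <_) (trans (*-comm g m) (sym p∸1≡m*g)) (*-monoʳ-< g u<m)
    t<p : t < p
    t<p = <-trans t<p∸1 (subst (p ∸ 1 <_) suc[p∸1]≡p (n<1+n (p ∸ 1)))
    divisible-r : p ∸ 1 ∣ n * t + k * (u * s % m)
    divisible-r = m∣⇒[p∸1]∣ (Mod-m.≈⇒∣-linear {k′} {n} m∣n+k′s (Mod-m.m%d≈m (u * s)))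
    only-r : ∀ i → i ≤ t → p ∸ 1 ∣ n * t + k * i → i ≡ u * s % m
    only-r i i≤t = Mod-m.window-unique {g} t<r+m i≤t
                 ∘ Mod-m.∣-linear⇒≈ {k′} {n} {s} {u} {i} m⊥k′ m∣n+k′s
                 ∘ [p∸1]∣⇒m∣
    ∑f^t≈0 : ∑[ x < p ] ((toℕ x ^ n * (toℕ x ^ k + toℕ a)) ^ t) ≈ 0
    ∑f^t≈0 = trans (∑-cong-≈ p (λ z _ → ^-cong t (sym (m%d≈m (z ^ n * (z ^ k + toℕ a))))))
                   (trans (cong (_% p) (sum-cong-≗ {p} (λ x → cong (_^ t) (sym (toℕ-fromℕ< _)))))
                          (bijective⇒∑^≈0 permutes t<p∸1))

  p∸1≤g*g : toℕ a ≢ 0 → Permutes p p-prime n k a → p ∸ 1 ≤ g * g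
  p∸1≤g*g a≢0 permutes = ≤-trans (≤-reflexive p∸1≡m*g) (*-monoˡ-≤ g (≮⇒≥ (g≮m a≢0 permutes)))

bounds-from-square : ∀ {p g} → 0 < g → p ∸ 1 ≤ g * g → p ≤ g * g + g + 1 × p < (g + 1) * (g + 1)
bounds-from-square {p} {g} 0<g p∸1≤g*g = p≤g*g+g+1 , p<[g+1]*[g+1]
  where
  open ≤-Reasoning
  p≤1+g*g : p ≤ 1 + g * g
  p≤1+g*g = ≤-trans (m≤n+m∸n p 1) (+-monoʳ-≤ 1 p∸1≤g*g)
  rearrange : ∀ g → 1 + g * g + g ≡ g * g + g + 1
  rearrange = solve-∀
  expand : ∀ g → 1 + g * g + (g + g) ≡ (g + 1) * (g + 1)
  expand = solve-∀
  p≤g*g+g+1 : p ≤ g * g + g + 1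
  p≤g*g+g+1 = begin
    p              ≤⟨ p≤1+g*g ⟩
    1 + g * g      ≤⟨ m≤m+n (1 + g * g) g ⟩
    1 + g * g + g  ≡⟨ rearrange g ⟩
    g * g + g + 1  ∎
  p<[g+1]*[g+1] : p < (g + 1) * (g + 1)
  p<[g+1]*[g+1] = begin-strict
    p                    ≤⟨ p≤1+g*g ⟩
    1 + g * g            <⟨ m<m+n (1 + g * g) (≤-trans 0<g (m≤m+n g g)) ⟩
    1 + g * g + (g + g)  ≡⟨ expand g ⟩
    (g + 1) * (g + 1)    ∎

theorem2p1 : (p : ℕ) (pp : Prime p) (n k : ℕ) (a : Fin p) →
    0 < n → 0 < k → toℕ a ≢ 0 →
    Permutes p pp n k a →
    (p ≤ gcd k (p ∸ 1) * gcd k (p ∸ 1) + gcd k (p ∸ 1) + 1)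
      × (p < (gcd k (p ∸ 1) + 1) * (gcd k (p ∸ 1) + 1))
theorem2p1 p pp n k a 0<n 0<k a≢0 permutes =
  bounds-from-square (>-nonZero⁻¹ g) (p∸1≤g*g a≢0 permutes)
  where open PermutationBound p pp n k a 0<n 0<k
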